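{- Let $k\ge2$. The row vectors $\mathbf{h}^k_t$ of $H_k$ satisfy: (i) $\mathbf{h}^k_1=(\mathbf{h}(Sd(\partial\Delta^{k-2})),0)$; (ii) for $1<t<k$, $\mathbf{h}^k_t=\mathbf{h}^t_t*\mathbf{h}(Sd(\partial\Delta^{k-t-1}))$; (iii) $\mathbf{h}^k_k=\mathbf{h}(Sd(\partial\Delta^{k-1}))-\sum_{i=1}^{k-1}\mathbf{h}^k_i$.
   Context: For $\pi\in\mathbb{S}_n$, $\mathrm{init}(\pi)=\min\{t:\{\pi_1,\ldots,\pi_t\}=[t]\}$ and $\mathrm{des}(\pi)=|\{i:\pi_i>\pi_{i+1}\}|$. $H_k=[h^k_{i,d}]_{i,d\in[k]}$ with $h^k_{i,d}=|\{\pi\in\mathbb{S}_k:\mathrm{init}(\pi)=i,\ \mathrm{des}(\pi)=d-1\}|$, and $\mathbf{h}^k_t=(h^k_{t,1},\ldots,h^k_{t,k})$ is its $t$-th row. $\mathbf{h}(Sd(\partial\Delta^{n-1}))=(A(n,0),\ldots,A(n,n-1))$ is the $h$-vector of the barycentric subdivision of the boundary of the $(n-1)$-simplex, where $A(n,i)=|\{\pi\in\mathbb{S}_n:\mathrm{des}(\pi)=i\}|$ (Eulerian numbers; for $n=1$ this is $(1)$). The convolution is $(a_0,\ldots,a_s)*(b_0,\ldots,b_t)=(c_0,\ldots,c_{s+t})$ with $c_j=\sum_{l=0}^{j}a_lb_{j-l}$ (out-of-range entries $0$). Sequences differing only by trailing zeros are identified. -}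

module Defs where

open import Data.Nat using (ℕ; zero; suc; _+_; _*_; _∸_; _<ᵇ_; _≡ᵇ_; _≤ᵇ_)
open import Data.Nat.Properties using (_≟_)
open import Data.Bool using (Bool; true; false; if_then_else_; _∧_; T)
open import Data.List using (List; []; _∷_; map; concatMap; filter; length; upTo; take)
open import Data.Bool.ListAction using (all; any)
open import Data.Nat.ListAction using (sum)
open import Data.List.Relation.Unary.Unique.DecPropositional _≟_ using (unique?)
open import Relation.Nullary.Decidable using (⌊_⌋)
open import Relation.Binary.PropositionalEquality using (_≡_)

range : ℕ → ℕ → List ℕ
range a b = map (λ x → a + x) (upTo (suc b ∸ a))

words : ℕ → ℕ → List (List ℕ)
words zero    n = [] ∷ []
words (suc m) n = concatMap (λ w → map (_∷ w) (range 1 n)) (words m n)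

-- the symmetric group S_n, as the list of all permutations in one-line
-- notation (π_1, ..., π_n): words of length n over [n] with distinct letters
perms : ℕ → List (List ℕ)
perms n = filter (λ w → unique? w) (words n n)

elemᵇ : ℕ → List ℕ → Bool
elemᵇ x = any (x ≡ᵇ_)

prefixIsInterval : List ℕ → ℕ → Bool
prefixIsInterval π t =
  all (λ x → (1 ≤ᵇ x) ∧ (x ≤ᵇ t)) (take t π) ∧ all (λ j → elemᵇ j (take t π)) (range 1 t)

initSearch : List ℕ → ℕ → ℕ → ℕ
initSearch π s zero       = length π
initSearch π s (suc fuel) = if prefixIsInterval π s then s else initSearch π (suc s) fuel

-- init(π) = min{ t : {π_1,...,π_t} = [t] }  (t ranging over 1..n; t = n always works)
init : List ℕ → ℕ
init π = initSearch π 1 (length π)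

des : List ℕ → ℕ
des []           = 0
des (x ∷ [])     = 0
des (x ∷ y ∷ ws) = (if y <ᵇ x then 1 else 0) + des (y ∷ ws)

count : {A : Set} → (A → Bool) → List A → ℕ
count p []       = 0
count p (x ∷ xs) = (if p x then 1 else 0) + count p xs

-- h^k_{i,d} = |{ π ∈ S_k : init π = i, des π = d - 1 }|
h : ℕ → ℕ → ℕ → ℕ
h k i d = count (λ π → (init π ≡ᵇ i) ∧ (des π ≡ᵇ (d ∸ 1))) (perms k)

hrow : ℕ → ℕ → List ℕ
hrow k t = map (h k t) (range 1 k)

A : ℕ → ℕ → ℕ
A n i = count (λ π → des π ≡ᵇ i) (perms n)

-- h(Sd(∂Δ^{n-1})) = (A(n,0), ..., A(n,n-1))
hSd : ℕ → List ℕ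
hSd n = map (A n) (range 0 (n ∸ 1))

-- entry j (0-based) of a sequence, with out-of-range entries 0
at : List ℕ → ℕ → ℕ
at []       j       = 0
at (x ∷ xs) zero    = x
at (x ∷ xs) (suc j) = at xs j

_⊛_ : List ℕ → List ℕ → List ℕ
a ⊛ b = map (λ j → sum (map (λ l → at a l * at b (j ∸ l)) (range 0 j)))
            (range 0 ((length a + length b) ∸ 2))

-- equality of sequences up to trailing zeros
_≈_ : List ℕ → List ℕ → Set
a ≈ b = ∀ j → at a j ≡ at b j

_∷ʳ'_ : List ℕ → ℕ → List ℕ
[]       ∷ʳ' y = y ∷ []
(x ∷ xs) ∷ʳ' y = x ∷ (xs ∷ʳ' y)

-- A permutation π ∈ S_k with init π = t < k splits uniquely as σ ⊕ τ: its first t letters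
-- form some σ ∈ S_t with init σ = t, and the remaining letters all exceed t, so they are
-- τ ∈ S_(k-t) shifted up by t.  The junction is an ascent, hence des π = des σ + des τ, and
-- counting by descents turns this bijection into the convolution
-- h^k_t = h^t_t * h(Sd(∂Δ^(k-t-1))); for t = 1 we have h^1_1 = (1), giving (i).  Part (iii)
-- holds because init π takes exactly one value in [1, k], so the rows of H_k add up to
-- the Eulerian numbers.

module Submission where

open import Defs
open import Data.Nat
open import Data.Nat.Properties
open import Data.Nat.ListAction using (sum)
open import Data.Bool using (Bool; true; false; if_then_else_; _∧_; T)
open import Data.Bool.Properties using (T?; T-∧; ∧-zeroʳ)
open import Data.List using (List; []; _∷_; [_]; map; concatMap; filterᵇ; length; _++_; applyUpTo; upTo; take; drop)
open import Data.List.Properties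
  using ( ∷-injectiveˡ; ∷-injectiveʳ; ++-identityʳ; ++-cancelˡ; map-injective; map-∘; map-++
        ; length-map; length-upTo; length-++; length-take; upTo-∷ʳ; take-all; take++drop≡id )
open import Data.Nat.ListAction.Properties using (sum-++)
open import Algebra.Properties.CommutativeSemigroup +-commutativeSemigroup
  using () renaming (interchange to +-interchange)
open import Data.List.Membership.Propositional using (_∈_; _∉_; find; lose)
open import Data.List.Membership.Propositional.Properties
open import Data.List.Membership.Propositional.Properties.WithK using (unique∧set⇒bag)
open import Data.List.Relation.Binary.BagAndSetEquality using (_∼[_]_; bag; ∼bag⇒↭)
open import Data.List.Relation.Binary.Permutation.Propositional.Properties using (↭-length)
open import Data.List.Membership.DecPropositional _≟_ using (_∈?_)
open import Data.List.Relation.Binary.Subset.Propositional using (_⊆_)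
open import Data.List.Relation.Unary.All as All using (All; []; _∷_)
import Data.List.Relation.Unary.All.Properties as All
open import Data.List.Relation.Unary.Any as Any using (here; there)
open import Data.List.Relation.Unary.Any.Properties using (any⁺)
open import Data.List.Relation.Unary.Unique.Propositional using (Unique; []; _∷_)
import Data.List.Relation.Unary.Unique.Propositional.Properties as Unique
open import Data.List.Relation.Unary.Unique.DecPropositional _≟_ using (unique?)
open import Data.Product using (_×_; _,_; proj₁; proj₂)
open import Data.Sum using (_⊎_; inj₁; inj₂)
open import Data.Empty using (⊥; ⊥-elim)
open import Data.Unit using (tt)
open import Function using (_∘_; id)
open import Function.Bundles using (mk⇔; Equivalence)
open import Relation.Binary.PropositionalEquality hiding ([_])
open import Relation.Nullary using (yes; no)
open import Relation.Nullary.Decidable using (dec-true; dec-false)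

private
  variable
    X Y : Set

-- Counting and summing over lists

ind : Bool → ℕ
ind b = if b then 1 else 0

ind-∧ : ∀ a b → ind (a ∧ b) ≡ ind a * ind b
ind-∧ false b     = refl
ind-∧ true  false = refl
ind-∧ true  true  = refl

count≡length-filter : ∀ (p : X → Bool) xs → count p xs ≡ length (filterᵇ p xs)
count≡length-filter p []       = refl
count≡length-filter p (x ∷ xs) with p x
... | true  = cong suc (count≡length-filter p xs)
... | false = count≡length-filter p xs

count-unique-cong : ∀ (p : X → Bool) {xs ys} → Unique xs → Unique ys →
  (∀ {x} → T (p x) → x ∈ xs → x ∈ ys) → (∀ {x} → T (p x) → x ∈ ys → x ∈ xs) →
  count p xs ≡ count p ys
count-unique-cong p {xs} {ys} xs! ys! xs⊆ys ys⊆xs = begin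
  count p xs                ≡⟨ count≡length-filter p xs ⟩
  length (filterᵇ p xs)     ≡⟨ ↭-length (∼bag⇒↭ filtered-bag) ⟩
  length (filterᵇ p ys)     ≡⟨ count≡length-filter p ys ⟨
  count p ys                ∎
  where
  open ≡-Reasoning
  filter! : ∀ {zs} → Unique zs → Unique (filterᵇ p zs)
  filter! = Unique.filter⁺ (T? ∘ p)
  restrict : ∀ {us vs} → (∀ {x} → T (p x) → x ∈ us → x ∈ vs) →
    ∀ {x} → x ∈ filterᵇ p us → x ∈ filterᵇ p vs
  restrict us⊆vs x∈ with ∈-filter⁻ (T? ∘ p) x∈
  ... | x∈us , px = ∈-filter⁺ (T? ∘ p) (us⊆vs px x∈us) px
  filtered-bag : filterᵇ p xs ∼[ bag ] filterᵇ p ys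
  filtered-bag = unique∧set⇒bag (filter! xs!) (filter! ys!) (mk⇔ (restrict xs⊆ys) (restrict ys⊆xs))

count-++ : ∀ (p : X → Bool) xs ys → count p (xs ++ ys) ≡ count p xs + count p ys
count-++ p []       ys = refl
count-++ p (x ∷ xs) ys = trans (cong (ind (p x) +_) (count-++ p xs ys)) (sym (+-assoc (ind (p x)) _ _))

count-map : ∀ (p : Y → Bool) (f : X → Y) xs → count p (map f xs) ≡ count (p ∘ f) xs
count-map p f []       = refl
count-map p f (x ∷ xs) = cong (ind (p (f x)) +_) (count-map p f xs)

count-cong : ∀ {p q : X → Bool} xs → (∀ {x} → x ∈ xs → p x ≡ q x) → count p xs ≡ count q xs
count-cong []       p≗q = refl
count-cong (x ∷ xs) p≗q = cong₂ _+_ (cong ind (p≗q (here refl))) (count-cong xs (p≗q ∘ there))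

count-none : ∀ {p : X → Bool} xs → (∀ {x} → x ∈ xs → p x ≡ false) → count p xs ≡ 0
count-none []       ¬p = refl
count-none (x ∷ xs) ¬p rewrite ¬p (here refl) = count-none xs (¬p ∘ there)

count≡sum-ind : ∀ (p : X → Bool) xs → count p xs ≡ sum (map (ind ∘ p) xs)
count≡sum-ind p []       = refl
count≡sum-ind p (x ∷ xs) = cong (ind (p x) +_) (count≡sum-ind p xs)

count-concatMap : ∀ (p : Y → Bool) (g : X → List Y) xs →
  count p (concatMap g xs) ≡ sum (map (count p ∘ g) xs)
count-concatMap p g []       = refl
count-concatMap p g (x ∷ xs) =
  trans (count-++ p (g x) (concatMap g xs)) (cong (count p (g x) +_) (count-concatMap p g xs))

sum-map-cong : ∀ {f g : X → ℕ} xs → (∀ {x} → x ∈ xs → f x ≡ g x) → sum (map f xs) ≡ sum (map g xs)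
sum-map-cong []       f≗g = refl
sum-map-cong (x ∷ xs) f≗g = cong₂ _+_ (f≗g (here refl)) (sum-map-cong xs (f≗g ∘ there))

sum-map-zero : ∀ (xs : List X) → sum (map (λ _ → 0) xs) ≡ 0
sum-map-zero []       = refl
sum-map-zero (x ∷ xs) = sum-map-zero xs

sum-map-+ : ∀ (f g : X → ℕ) xs → sum (map (λ x → f x + g x) xs) ≡ sum (map f xs) + sum (map g xs)
sum-map-+ f g []       = refl
sum-map-+ f g (x ∷ xs) rewrite sum-map-+ f g xs = +-interchange (f x) (g x) (sum (map f xs)) (sum (map g xs))

sum-map-swap : ∀ (F : X → Y → ℕ) xs ys →
  sum (map (λ x → sum (map (F x) ys)) xs) ≡ sum (map (λ y → sum (map (λ x → F x y) xs)) ys)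
sum-map-swap F []       ys = sym (sum-map-zero ys)
sum-map-swap F (x ∷ xs) ys rewrite sum-map-swap F xs ys = sym (sum-map-+ (F x) _ ys)

sum-map-*ˡ : ∀ (f : X → ℕ) c xs → sum (map (λ x → c * f x) xs) ≡ c * sum (map f xs)
sum-map-*ˡ f c []       = sym (*-zeroʳ c)
sum-map-*ˡ f c (x ∷ xs) rewrite sum-map-*ˡ f c xs = sym (*-distribˡ-+ c (f x) (sum (map f xs)))

sum-map-*ʳ : ∀ (f : X → ℕ) c xs → sum (map (λ x → f x * c) xs) ≡ sum (map f xs) * c
sum-map-*ʳ f c []       = refl
sum-map-*ʳ f c (x ∷ xs) rewrite sum-map-*ʳ f c xs = sym (*-distribʳ-+ c (f x) (sum (map f xs)))

≡ᵇ-refl : ∀ n → (n ≡ᵇ n) ≡ true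
≡ᵇ-refl n = dec-true (n ≟ n) refl

≢⇒≡ᵇ-false : ∀ {m n} → m ≢ n → (m ≡ᵇ n) ≡ false
≢⇒≡ᵇ-false {m} {n} = dec-false (m ≟ n)

δ : ℕ → ℕ → ℕ
δ e l = ind (e ≡ᵇ l)

sum-map-δ-∉ : ∀ {e} (f : ℕ → ℕ) xs → e ∉ xs → sum (map (λ l → δ e l * f l) xs) ≡ 0
sum-map-δ-∉ f []       e∉ = refl
sum-map-δ-∉ f (x ∷ xs) e∉ rewrite ≢⇒≡ᵇ-false (e∉ ∘ here) = sum-map-δ-∉ f xs (e∉ ∘ there)

sum-map-δ : ∀ {e} (f : ℕ → ℕ) xs → Unique xs → e ∈ xs → sum (map (λ l → δ e l * f l) xs) ≡ f e
sum-map-δ {e} f (x ∷ xs) (e∉xs ∷ _) (here refl)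
  rewrite ≡ᵇ-refl e | sum-map-δ-∉ f xs (λ e∈xs → All.lookup e∉xs e∈xs refl) =
  trans (+-identityʳ _) (+-identityʳ _)
sum-map-δ {e} f (x ∷ xs) (x∉xs ∷ xs!) (there e∈xs)
  rewrite ≢⇒≡ᵇ-false {e} {x} (λ { refl → All.lookup x∉xs e∈xs refl }) = sum-map-δ f xs xs! e∈xs

unique-concatMap⁺ : ∀ (g : X → List Y) {xs} → Unique xs → (∀ x → Unique (g x)) →
  (∀ {x x′ y} → x ∈ xs → x′ ∈ xs → y ∈ g x → y ∈ g x′ → x ≡ x′) → Unique (concatMap g xs)
unique-concatMap⁺ g {[]}     _           g! disjoint = []
unique-concatMap⁺ g {x ∷ xs} (x∉xs ∷ xs!) g! disjoint =
  Unique.++⁺ (g! x) (unique-concatMap⁺ g xs! g! (λ x∈ x′∈ → disjoint (there x∈) (there x′∈))) λ where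
    (y∈gx , y∈rest) → let (x′ , x′∈xs , y∈gx′) = find (∈-concatMap⁻ g y∈rest)
                      in All.lookup x∉xs x′∈xs (disjoint (here refl) (there x′∈xs) y∈gx y∈gx′)

unique-++⁻ʳ : ∀ xs {ys : List X} → Unique (xs ++ ys) → Unique ys
unique-++⁻ʳ []       ys!          = ys!
unique-++⁻ʳ (x ∷ xs) (_ ∷ xs++ys!) = unique-++⁻ʳ xs xs++ys!

unique-++⇒disjoint : ∀ xs {ys : List X} {v} → Unique (xs ++ ys) → v ∈ xs → v ∉ ys
unique-++⇒disjoint (x ∷ xs) (x∉ ∷ _)     (here refl) v∈ys = All.lookup (All.++⁻ʳ xs x∉) v∈ys refl
unique-++⇒disjoint (x ∷ xs) (_ ∷ xs++ys!) (there v∈xs) = unique-++⇒disjoint xs xs++ys! v∈xs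

unique-⊆⇒length-≤ : ∀ {xs ys : List X} → Unique xs → xs ⊆ ys → length xs ≤ length ys
unique-⊆⇒length-≤ {xs = []}     _            _     = z≤n
unique-⊆⇒length-≤ {xs = x ∷ xs} (x∉xs ∷ xs!) xs⊆ys with ∈-∃++ (xs⊆ys (here refl))
... | ys₁ , ys₂ , refl = begin
  suc (length xs)                ≤⟨ s≤s (unique-⊆⇒length-≤ xs! xs⊆ys₁++ys₂) ⟩
  suc (length (ys₁ ++ ys₂))      ≡⟨ cong suc (length-++ ys₁) ⟩
  suc (length ys₁ + length ys₂)  ≡⟨ +-suc (length ys₁) (length ys₂) ⟨
  length ys₁ + length (x ∷ ys₂)  ≡⟨ length-++ ys₁ ⟨
  length (ys₁ ++ x ∷ ys₂)        ∎
  where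
  open ≤-Reasoning
  xs⊆ys₁++ys₂ : xs ⊆ ys₁ ++ ys₂
  xs⊆ys₁++ys₂ {y} y∈xs with ∈-++⁻ ys₁ (xs⊆ys (there y∈xs))
  ... | inj₁ y∈ys₁        = ∈-++⁺ˡ y∈ys₁
  ... | inj₂ (here refl)  = ⊥-elim (All.lookup x∉xs y∈xs refl)
  ... | inj₂ (there y∈ys₂) = ∈-++⁺ʳ ys₁ y∈ys₂

unique-⊆-length-≥⇒⊇ : ∀ {xs ys : List ℕ} → Unique xs → xs ⊆ ys → length ys ≤ length xs → ys ⊆ xs
unique-⊆-length-≥⇒⊇ {xs} xs! xs⊆ys ys≤xs {j} j∈ys with j ∈? xs
... | yes j∈xs = j∈xs
... | no  j∉xs = ⊥-elim (<⇒≱ (unique-⊆⇒length-≤ (All.¬Any⇒All¬ xs j∉xs ∷ xs!) j∷xs⊆ys) ys≤xs)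
  where
  j∷xs⊆ys : j ∷ xs ⊆ _
  j∷xs⊆ys (here refl) = j∈ys
  j∷xs⊆ys (there y∈xs) = xs⊆ys y∈xs

take-++-≤ : ∀ {s} (σ ρ : List X) → s ≤ length σ → take s (σ ++ ρ) ≡ take s σ
take-++-≤ {s = zero}  σ       ρ _         = refl
take-++-≤ {s = suc s} (x ∷ σ) ρ (s≤s s≤σ) = cong (x ∷_) (take-++-≤ σ ρ s≤σ)

map-+-∸ : ∀ {t} ρ → All (t ≤_) ρ → map (t +_) (map (_∸ t) ρ) ≡ ρ
map-+-∸ []      []           = refl
map-+-∸ (x ∷ ρ) (t≤x ∷ t≤ρ) = cong₂ _∷_ (m+[n∸m]≡n t≤x) (map-+-∸ ρ t≤ρ)

length-range : ∀ a b → length (range a b) ≡ suc b ∸ a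
length-range a b = trans (length-map (a +_) (upTo (suc b ∸ a))) (length-upTo (suc b ∸ a))

∈-range⁺ : ∀ {a b x} → a ≤ x → x ≤ b → x ∈ range a b
∈-range⁺ {a} {b} {x} a≤x x≤b =
  subst (_∈ range a b) (m+[n∸m]≡n a≤x) (∈-map⁺ (a +_) (∈-upTo⁺ (∸-monoˡ-< (s≤s x≤b) a≤x)))

∈-range⁻ : ∀ {a b x} → x ∈ range a b → a ≤ x × x ≤ b
∈-range⁻ {a} {b} x∈ with ∈-map⁻ (a +_) x∈
... | y , y∈ , refl =
  m≤m+n a y , s≤s⁻¹ (subst (_≤ suc b) (cong suc (+-comm y a)) (m≤o∸n⇒m+n≤o (suc y) a≤1+b y<))
  where
  y< : y < suc b ∸ a
  y< = ∈-upTo⁻ y∈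
  a≤1+b : a ≤ suc b
  a≤1+b = <⇒≤ (m∸n≢0⇒n<m (λ eq → n≮0 (subst (y <_) eq y<)))

range-unique : ∀ a b → Unique (range a b)
range-unique a b = Unique.map⁺ (+-cancelˡ-≡ a _ _) (Unique.upTo⁺ (suc b ∸ a))

at-map-applyUpTo : ∀ (g f : ℕ → ℕ) {n j} → j < n → at (map g (applyUpTo f n)) j ≡ g (f j)
at-map-applyUpTo g f {suc n} {zero}  _         = refl
at-map-applyUpTo g f {suc n} {suc j} (s≤s j<n) = at-map-applyUpTo g (f ∘ suc) j<n

at-map-applyUpTo-≥ : ∀ (g f : ℕ → ℕ) {n j} → n ≤ j → at (map g (applyUpTo f n)) j ≡ 0
at-map-applyUpTo-≥ g f {zero}              _         = refl
at-map-applyUpTo-≥ g f {suc n} {suc j} (s≤s n≤j) = at-map-applyUpTo-≥ g (f ∘ suc) n≤j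

at-map-range : ∀ (g : ℕ → ℕ) a b {j} → j < suc b ∸ a → at (map g (range a b)) j ≡ g (a + j)
at-map-range g a b j< =
  trans (cong (λ xs → at xs _) (sym (map-∘ (upTo (suc b ∸ a))))) (at-map-applyUpTo (g ∘ (a +_)) id j<)

at-map-range-≥ : ∀ (g : ℕ → ℕ) a b {j} → suc b ∸ a ≤ j → at (map g (range a b)) j ≡ 0
at-map-range-≥ g a b j≥ =
  trans (cong (λ xs → at xs _) (sym (map-∘ (upTo (suc b ∸ a))))) (at-map-applyUpTo-≥ (g ∘ (a +_)) id j≥)

sum-map-range-snoc : ∀ (f : ℕ → ℕ) n → sum (map f (range 1 (suc n))) ≡ sum (map f (range 1 n)) + f (suc n)
sum-map-range-snoc f n = begin
  sum (map f (map suc (upTo (suc n))))             ≡⟨ cong (sum ∘ map f ∘ map suc) (upTo-∷ʳ n) ⟨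
  sum (map f (map suc (upTo n ++ [ n ])))          ≡⟨ cong (sum ∘ map f) (map-++ suc (upTo n) [ n ]) ⟩
  sum (map f (map suc (upTo n) ++ [ suc n ]))      ≡⟨ cong sum (map-++ f (map suc (upTo n)) [ suc n ]) ⟩
  sum (map f (map suc (upTo n)) ++ [ f (suc n) ])  ≡⟨ sum-++ (map f (map suc (upTo n))) [ f (suc n) ] ⟩
  sum (map f (range 1 n)) + (f (suc n) + 0)        ≡⟨ cong (sum (map f (range 1 n)) +_) (+-identityʳ (f (suc n))) ⟩
  sum (map f (range 1 n)) + f (suc n)              ∎
  where open ≡-Reasoning

at-≥ : ∀ xs {j} → length xs ≤ j → at xs j ≡ 0
at-≥ []       _                = refl
at-≥ (x ∷ xs) {suc j} (s≤s xs≤j) = at-≥ xs xs≤j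

cauchy-term-vanishes : ∀ a b {j} l → length a + length b ∸ 2 < j → at a l * at b (j ∸ l) ≡ 0
cauchy-term-vanishes []      b       l _ = refl
cauchy-term-vanishes (x ∷ a) []      l _ = *-zeroʳ (at (x ∷ a) l)
cauchy-term-vanishes (x ∷ a) (y ∷ b) {j} l a+b<j with l <? length (x ∷ a)
... | no  l≮ = cong (_* at (y ∷ b) (j ∸ l)) (at-≥ (x ∷ a) (≮⇒≥ l≮))
... | yes l< =
  trans (cong (at (x ∷ a) l *_) (at-≥ (y ∷ b) (m+n≤o⇒m≤o∸n (suc (length b)) b+l<j))) (*-zeroʳ (at (x ∷ a) l))
  where
  b+l<j : suc (length b) + l ≤ j
  b+l<j = begin
    suc (length b + l)         ≤⟨ s≤s (+-monoʳ-≤ (length b) (s≤s⁻¹ l<)) ⟩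
    suc (length b + length a)  ≡⟨ cong suc (+-comm (length b) (length a)) ⟩
    suc (length a + length b)  ≡⟨ cong (λ n → suc (n ∸ 1)) (+-suc (length a) (length b)) ⟨
    suc (length a + length (y ∷ b) ∸ 1) ≤⟨ a+b<j ⟩
    j                          ∎
    where open ≤-Reasoning

at-⊛ : ∀ a b j → at (a ⊛ b) j ≡ sum (map (λ l → at a l * at b (j ∸ l)) (range 0 j))
at-⊛ a b j with j <? suc (length a + length b ∸ 2)
... | yes j< = at-map-range _ 0 _ j<
... | no  j≮ = trans (at-map-range-≥ _ 0 _ (≮⇒≥ j≮)) (sym (trans
  (sum-map-cong (range 0 j) (λ {l} _ → cauchy-term-vanishes a b l (≮⇒≥ j≮))) (sum-map-zero (range 0 j))))

at-∷ʳ'-0 : ∀ xs j → at (xs ∷ʳ' 0) j ≡ at xs j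
at-∷ʳ'-0 []       zero    = refl
at-∷ʳ'-0 []       (suc j) = refl
at-∷ʳ'-0 (x ∷ xs) zero    = refl
at-∷ʳ'-0 (x ∷ xs) (suc j) = at-∷ʳ'-0 xs j

≡ᵇ-cong : ∀ {m n m′ n′} → (m ≡ n → m′ ≡ n′) → (m′ ≡ n′ → m ≡ n) →
  (m ≡ᵇ n) ≡ (m′ ≡ᵇ n′)
≡ᵇ-cong {m} {n} {m′} {n′} to from with m ≟ n
... | yes eq = trans (dec-true (m ≟ n) eq) (sym (dec-true (m′ ≟ n′) (to eq)))
... | no  ne = trans (dec-false (m ≟ n) ne) (sym (dec-false (m′ ≟ n′) (ne ∘ from)))

ind-+≡ᵇ : ∀ e x j → ind (e + x ≡ᵇ j) ≡ sum (map (λ l → δ e l * ind (x ≡ᵇ j ∸ l)) (range 0 j))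
ind-+≡ᵇ e x j with e ≤? j
... | yes e≤j = trans (cong ind (≡ᵇ-cong to from))
  (sym (sum-map-δ (λ l → ind (x ≡ᵇ j ∸ l)) (range 0 j) (range-unique 0 j) (∈-range⁺ z≤n e≤j)))
  where
  to : e + x ≡ j → x ≡ j ∸ e
  to refl = sym (m+n∸m≡n e x)
  from : x ≡ j ∸ e → e + x ≡ j
  from refl = m+[n∸m]≡n e≤j
... | no  e≰j = trans (cong ind (≢⇒≡ᵇ-false λ e+x≡j → e≰j (subst (e ≤_) e+x≡j (m≤m+n e x))))
  (sym (sum-map-δ-∉ (λ l → ind (x ≡ᵇ j ∸ l)) (range 0 j) (e≰j ∘ proj₂ ∘ ∈-range⁻ {0})))

ind-∧-+≡ᵇ : ∀ b e x j →
  ind (b ∧ (e + x ≡ᵇ j)) ≡ sum (map (λ l → ind (b ∧ (e ≡ᵇ l)) * ind (x ≡ᵇ j ∸ l)) (range 0 j))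
ind-∧-+≡ᵇ b e x j = begin
  ind (b ∧ (e + x ≡ᵇ j))
    ≡⟨ ind-∧ b _ ⟩
  ind b * ind (e + x ≡ᵇ j)
    ≡⟨ cong (ind b *_) (ind-+≡ᵇ e x j) ⟩
  ind b * sum (map (λ l → δ e l * ind (x ≡ᵇ j ∸ l)) (range 0 j))
    ≡⟨ sum-map-*ˡ _ (ind b) (range 0 j) ⟨
  sum (map (λ l → ind b * (δ e l * ind (x ≡ᵇ j ∸ l))) (range 0 j))
    ≡⟨ sum-map-cong (range 0 j) (λ {l} _ →
         trans (sym (*-assoc (ind b) _ _)) (cong (_* _) (sym (ind-∧ b (e ≡ᵇ l))))) ⟩
  sum (map (λ l → ind (b ∧ (e ≡ᵇ l)) * ind (x ≡ᵇ j ∸ l)) (range 0 j))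
    ∎
  where open ≡-Reasoning

count-+-convolution : ∀ (p : X → Bool) (f : X → ℕ) (g : Y → ℕ) xs ys j →
  sum (map (λ x → count (λ y → p x ∧ (f x + g y ≡ᵇ j)) ys) xs)
  ≡ sum (map (λ l → count (λ x → p x ∧ (f x ≡ᵇ l)) xs * count (λ y → g y ≡ᵇ j ∸ l) ys) (range 0 j))
count-+-convolution {X = X} {Y = Y} p f g xs ys j = begin
  sum (map (λ x → count (λ y → p x ∧ (f x + g y ≡ᵇ j)) ys) xs)
    ≡⟨ sum-map-cong xs (λ {x} _ →
         trans (count≡sum-ind _ ys) (sum-map-cong ys (λ {y} _ → ind-∧-+≡ᵇ (p x) (f x) (g y) j))) ⟩
  sum (map (λ x → sum (map (λ y → sum (map (λ l → P x l * Q y l) (range 0 j))) ys)) xs)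
    ≡⟨ sum-map-cong xs (λ {x} _ → sum-map-swap (λ y l → P x l * Q y l) ys (range 0 j)) ⟩
  sum (map (λ x → sum (map (λ l → sum (map (λ y → P x l * Q y l) ys)) (range 0 j))) xs)
    ≡⟨ sum-map-swap (λ x l → sum (map (λ y → P x l * Q y l) ys)) xs (range 0 j) ⟩
  sum (map (λ l → sum (map (λ x → sum (map (λ y → P x l * Q y l) ys)) xs)) (range 0 j))
    ≡⟨ sum-map-cong (range 0 j) (λ {l} _ →
         trans (sum-map-cong xs (λ {x} _ → sum-map-*ˡ (λ y → Q y l) (P x l) ys))
               (sum-map-*ʳ (λ x → P x l) _ xs)) ⟩
  sum (map (λ l → sum (map (λ x → P x l) xs) * sum (map (λ y → Q y l) ys)) (range 0 j))
    ≡⟨ sum-map-cong (range 0 j) (λ {l} _ → sym (cong₂ _*_ (count≡sum-ind _ xs) (count≡sum-ind _ ys))) ⟩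
  sum (map (λ l → count (λ x → p x ∧ (f x ≡ᵇ l)) xs * count (λ y → g y ≡ᵇ j ∸ l) ys) (range 0 j)) ∎
  where
  open ≡-Reasoning
  P : X → ℕ → ℕ
  P x l = ind (p x ∧ (f x ≡ᵇ l))
  Q : Y → ℕ → ℕ
  Q y l = ind (g y ≡ᵇ j ∸ l)

-- Permutations

Letter : ℕ → ℕ → Set
Letter n x = 1 ≤ x × x ≤ n

record IsPermutation (n : ℕ) (π : List ℕ) : Set where
  constructor isPermutation
  field
    length≡ : length π ≡ n
    letters : All (Letter n) π
    unique  : Unique π

∈-words⁻ : ∀ m n {w} → w ∈ words m n → length w ≡ m × All (Letter n) w
∈-words⁻ zero    n (here refl) = refl , []
∈-words⁻ (suc m) n w∈ with find (∈-concatMap⁻ (λ w → map (_∷ w) (range 1 n)) {xs = words m n} w∈)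
... | w , w∈words , w∈ext with ∈-map⁻ (_∷ w) w∈ext
... | x , x∈range , refl with ∈-words⁻ m n w∈words
... | length≡ , letters = cong suc length≡ , ∈-range⁻ x∈range ∷ letters

∈-words⁺ : ∀ m n {w} → length w ≡ m → All (Letter n) w → w ∈ words m n
∈-words⁺ zero    n {[]}    _       _                   = here refl
∈-words⁺ (suc m) n {x ∷ w} length≡ ((1≤x , x≤n) ∷ letters) =
  ∈-concatMap⁺ (λ w → map (_∷ w) (range 1 n))
    (lose (∈-words⁺ m n (suc-injective length≡) letters) (∈-map⁺ (_∷ w) (∈-range⁺ 1≤x x≤n)))

words-unique : ∀ m n → Unique (words m n)
words-unique zero    n = [] ∷ []
words-unique (suc m) n =
  unique-concatMap⁺ (λ w → map (_∷ w) (range 1 n)) (words-unique m n)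
    (λ w → Unique.map⁺ ∷-injectiveˡ (range-unique 1 n))
    λ _ _ y∈ y∈′ → let (_ , _ , eq) = ∈-map⁻ _ y∈ ; (_ , _ , eq′) = ∈-map⁻ _ y∈′
                   in ∷-injectiveʳ (trans (sym eq) eq′)

∈-perms⁻ : ∀ n {π} → π ∈ perms n → IsPermutation n π
∈-perms⁻ n π∈ with ∈-filter⁻ unique? {xs = words n n} π∈
... | π∈words , π! with ∈-words⁻ n n π∈words
... | length≡ , letters = isPermutation length≡ letters π!

∈-perms⁺ : ∀ n {π} → IsPermutation n π → π ∈ perms n
∈-perms⁺ n (isPermutation length≡ letters π!) = ∈-filter⁺ unique? (∈-words⁺ n n length≡ letters) π!

perms-unique : ∀ n → Unique (perms n)
perms-unique n = Unique.filter⁺ unique? (words-unique n n)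

IsPermutation⇒∈ : ∀ {n π j} → IsPermutation n π → Letter n j → j ∈ π
IsPermutation⇒∈ {n} {π} (isPermutation length≡ letters π!) (1≤j , j≤n) =
  unique-⊆-length-≥⇒⊇ π! π⊆range range≤π (∈-range⁺ 1≤j j≤n)
  where
  π⊆range : π ⊆ range 1 n
  π⊆range x∈π = let (1≤x , x≤n) = All.lookup letters x∈π in ∈-range⁺ 1≤x x≤n
  range≤π : length (range 1 n) ≤ length π
  range≤π = ≤-reflexive (trans (length-range 1 n) (sym length≡))

-- The statistics init and des

elemᵇ⁺ : ∀ {x xs} → x ∈ xs → T (elemᵇ x xs)
elemᵇ⁺ {x} x∈ = any⁺ (x ≡ᵇ_) (Any.map (λ { refl → ≡⇒≡ᵇ x x refl }) x∈)

prefixIsInterval⇒letters : ∀ π t → T (prefixIsInterval π t) → All (Letter t) (take t π)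
prefixIsInterval⇒letters π t holds =
  All.map (λ x-bounded → let (1≤x , x≤t) = Equivalence.to T-∧ x-bounded
                         in ≤ᵇ⇒≤ 1 _ 1≤x , ≤ᵇ⇒≤ _ t x≤t)
          (All.all⁺ _ (take t π) (proj₁ (Equivalence.to T-∧ holds)))

IsPermutation⇒prefixIsInterval : ∀ {t σ} → IsPermutation t σ → T (prefixIsInterval σ t)
IsPermutation⇒prefixIsInterval {t} {σ} σ-perm@(isPermutation refl letters _)
  rewrite take-all (length σ) σ ≤-refl =
  Equivalence.from T-∧
    ( All.all⁻ _ (All.map (λ (1≤x , x≤t) → Equivalence.from T-∧ (≤⇒≤ᵇ 1≤x , ≤⇒≤ᵇ x≤t)) letters)
    , All.all⁻ _ (All.tabulate (λ j∈ → elemᵇ⁺ (IsPermutation⇒∈ σ-perm (∈-range⁻ j∈)))))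

-- s + f ≡ 1 + length σ: the search on σ has just enough fuel to reach s = length σ, where it stops.
initSearch-++ : ∀ σ ρ {s f f′} → T (prefixIsInterval σ (length σ)) →
  s ≤ length σ → s + f ≡ suc (length σ) → f ≤ f′ → initSearch (σ ++ ρ) s f′ ≡ initSearch σ s f
initSearch-++ σ ρ {s} {zero} _ s≤σ s+0≡ _ =
  ⊥-elim (<⇒≱ (s≤s s≤σ) (≤-reflexive (trans (sym s+0≡) (+-identityʳ s))))
initSearch-++ σ ρ {s} {suc f} {suc f′} σ-interval s≤σ s+f≡ (s≤s f≤f′)
  rewrite take-++-≤ σ ρ s≤σ with prefixIsInterval σ s in eq
... | true  = refl
... | false with s ≟ length σ
...   | yes refl = ⊥-elim (subst T eq σ-interval)
...   | no  s≢σ  = initSearch-++ σ ρ σ-interval (≤∧≢⇒< s≤σ s≢σ) (trans (sym (+-suc s f)) s+f≡) f≤f′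

init-++ : ∀ {t σ} ρ → IsPermutation t σ → 1 ≤ t → init (σ ++ ρ) ≡ init σ
init-++ {σ = σ} ρ σ-perm@(isPermutation refl _ _) 1≤t =
  initSearch-++ σ ρ (IsPermutation⇒prefixIsInterval σ-perm) 1≤t refl
    (subst (length σ ≤_) (sym (length-++ σ)) (m≤m+n (length σ) (length ρ)))

initSearch-stops : ∀ π s f → let r = initSearch π s f in
  r ≡ length π ⊎ (T (prefixIsInterval π r) × s ≤ r × r < s + f)
initSearch-stops π s zero = inj₁ refl
initSearch-stops π s (suc f) with prefixIsInterval π s in eq
... | true  = inj₂ (subst T (sym eq) tt , ≤-refl , subst (s <_) (sym (+-suc s f)) (s≤s (m≤m+n s f)))
... | false with initSearch-stops π (suc s) f
...   | inj₁ r≡π                = inj₁ r≡π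
...   | inj₂ (holds , s<r , r<) = inj₂ (holds , <⇒≤ s<r , subst (initSearch π (suc s) f <_) (sym (+-suc s f)) r<)

init-letter : ∀ {n π} → IsPermutation n π → 1 ≤ n → Letter n (init π)
init-letter {π = π} (isPermutation refl _ _) 1≤n with initSearch-stops π 1 (length π)
... | inj₁ r≡n            = subst (1 ≤_) (sym r≡n) 1≤n , ≤-reflexive r≡n
... | inj₂ (_ , 1≤r , r<) = 1≤r , s≤s⁻¹ r<

init-prefixIsInterval : ∀ π → init π < length π → T (prefixIsInterval π (init π))
init-prefixIsInterval π init<π with initSearch-stops π 1 (length π)
... | inj₁ r≡π          = ⊥-elim (<⇒≢ init<π r≡π)
... | inj₂ (holds , _) = holds

<ᵇ-cancelˡ-+ : ∀ t x y → (t + y <ᵇ t + x) ≡ (y <ᵇ x)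
<ᵇ-cancelˡ-+ zero    x y = refl
<ᵇ-cancelˡ-+ (suc t) x y = <ᵇ-cancelˡ-+ t x y

des-map-+ : ∀ t τ → des (map (t +_) τ) ≡ des τ
des-map-+ t []          = refl
des-map-+ t (x ∷ [])    = refl
des-map-+ t (x ∷ y ∷ τ) = cong₂ _+_ (cong ind (<ᵇ-cancelˡ-+ t x y)) (des-map-+ t (y ∷ τ))

<⇒<ᵇ-false : ∀ {x y} → x < y → (y <ᵇ x) ≡ false
<⇒<ᵇ-false {x} {y} x<y = dec-false (y <? x) (<⇒≯ x<y)

des-++ : ∀ xs {y} ys → All (_< y) xs → des (xs ++ y ∷ ys) ≡ des xs + des (y ∷ ys)
des-++ []           ys []                 = refl
des-++ (x ∷ [])     ys (x<y ∷ [])         rewrite <⇒<ᵇ-false x<y = refl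
des-++ (x ∷ x′ ∷ xs) ys (_ ∷ x′∷xs<y) =
  trans (cong (ind (x′ <ᵇ x) +_) (des-++ (x′ ∷ xs) ys x′∷xs<y)) (sym (+-assoc (ind (x′ <ᵇ x)) _ _))

des-++-map-+ : ∀ {t σ} τ → All (Letter t) σ → All (1 ≤_) τ → des (σ ++ map (t +_) τ) ≡ des σ + des τ
des-++-map-+ {σ = σ} [] _ _ = trans (cong des (++-identityʳ σ)) (sym (+-identityʳ (des σ)))
des-++-map-+ {t} {σ} (y ∷ ys) σ-letters (1≤y ∷ _) =
  trans (des-++ σ (map (t +_) ys) (All.map (λ (_ , x≤t) → ≤-trans (s≤s x≤t) t+1≤t+y) σ-letters))
        (cong (des σ +_) (des-map-+ t (y ∷ ys)))
  where
  t+1≤t+y : suc t ≤ t + y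
  t+1≤t+y = subst (_≤ t + y) (+-comm t 1) (+-monoʳ-≤ t 1≤y)

des-≤ : ∀ π → des π ≤ length π ∸ 1
des-≤ []          = z≤n
des-≤ (x ∷ [])    = z≤n
des-≤ (x ∷ y ∷ π) = +-mono-≤ (ind≤1 (y <ᵇ x)) (des-≤ (y ∷ π))
  where
  ind≤1 : ∀ b → ind b ≤ 1
  ind≤1 true  = ≤-refl
  ind≤1 false = z≤n

des≡ᵇ-false : ∀ n {π j} → π ∈ perms n → n ∸ 1 < j → (des π ≡ᵇ j) ≡ false
des≡ᵇ-false n {π} {j} π∈ n-1<j = ≢⇒≡ᵇ-false {des π} {j} λ { refl → <⇒≱ n-1<j des≤n-1 }
  where
  des≤n-1 : des π ≤ n ∸ 1
  des≤n-1 = subst (λ l → des π ≤ l ∸ 1) (IsPermutation.length≡ (∈-perms⁻ n π∈)) (des-≤ π)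

-- Direct sums of permutations

_⊕_ : List ℕ → List ℕ → List ℕ
σ ⊕ τ = σ ++ map (length σ +_) τ

take-length-⊕ : ∀ σ τ → take (length σ) (σ ⊕ τ) ≡ σ
take-length-⊕ σ τ = trans (take-++-≤ σ _ ≤-refl) (take-all (length σ) σ ≤-refl)

⊕-injectiveʳ : ∀ σ {τ τ′} → σ ⊕ τ ≡ σ ⊕ τ′ → τ ≡ τ′
⊕-injectiveʳ σ eq = map-injective (+-cancelˡ-≡ (length σ) _ _) (++-cancelˡ σ _ _ eq)

⊕-isPermutation : ∀ {t m σ τ} → IsPermutation t σ → IsPermutation m τ → IsPermutation (t + m) (σ ⊕ τ)
⊕-isPermutation {t} {m} {σ} {τ} (isPermutation refl σ-letters σ!) (isPermutation refl τ-letters τ!) =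
  isPermutation (trans (length-++ σ) (cong (t +_) (length-map (t +_) τ)))
    (All.++⁺ (All.map (λ (1≤x , x≤t) → 1≤x , ≤-trans x≤t (m≤m+n t m)) σ-letters)
             (All.map⁺ (All.map (λ {y} (1≤y , y≤m) → ≤-trans 1≤y (m≤n+m y t) , +-monoʳ-≤ t y≤m)
                                τ-letters)))
    (Unique.++⁺ σ! (Unique.map⁺ (+-cancelˡ-≡ t _ _) τ!) λ (x∈σ , x∈τ′) → disjoint x∈σ x∈τ′)
  where
  disjoint : ∀ {x} → x ∈ σ → x ∈ map (t +_) τ → ⊥
  disjoint x∈σ x∈τ′ with ∈-map⁻ (t +_) x∈τ′
  ... | y , y∈τ , refl = <⇒≱ (m<m+n t (proj₁ (All.lookup τ-letters y∈τ))) (proj₂ (All.lookup σ-letters x∈σ))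

take-isPermutation : ∀ {n t π} → IsPermutation n π → t ≤ n → T (prefixIsInterval π t) →
  IsPermutation t (take t π)
take-isPermutation {t = t} {π} (isPermutation refl _ π!) t≤n holds =
  isPermutation (trans (length-take t π) (m≤n⇒m⊓n≡m t≤n)) (prefixIsInterval⇒letters π t holds)
    (Unique.take⁺ t π!)

++⁻ʳ-isPermutation : ∀ {n t} σ ρ → IsPermutation n (σ ++ ρ) → IsPermutation t σ →
  All (t <_) ρ × IsPermutation (n ∸ t) (map (_∸ t) ρ)
++⁻ʳ-isPermutation {n} {t} σ ρ (isPermutation σρ-length σρ-letters σρ!) σ-perm@(isPermutation refl _ _) =
  t<ρ , isPermutation τ-length τ-letters (Unique.map⁻ (subst Unique (sym (map-+-∸ ρ (All.map <⇒≤ t<ρ))) ρ!))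
  where
  ρ! : Unique ρ
  ρ! = unique-++⁻ʳ σ σρ!
  ρ-letters : All (Letter n) ρ
  ρ-letters = All.++⁻ʳ σ σρ-letters
  t<ρ : All (t <_) ρ
  t<ρ = All.tabulate λ {v} v∈ρ → ≰⇒> λ v≤t →
    unique-++⇒disjoint σ σρ! (IsPermutation⇒∈ σ-perm (proj₁ (All.lookup ρ-letters v∈ρ) , v≤t)) v∈ρ
  τ-length : length (map (_∸ t) ρ) ≡ n ∸ t
  τ-length = begin
    length (map (_∸ t) ρ)  ≡⟨ length-map (_∸ t) ρ ⟩
    length ρ               ≡⟨ m+n∸m≡n t (length ρ) ⟨
    t + length ρ ∸ t       ≡⟨ cong (_∸ t) (trans (sym (length-++ σ)) σρ-length) ⟩
    n ∸ t                  ∎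
    where open ≡-Reasoning
  τ-letters : All (Letter (n ∸ t)) (map (_∸ t) ρ)
  τ-letters =
    All.map⁺ (All.zipWith (λ (t<v , (_ , v≤n)) → m<n⇒0<n∸m t<v , ∸-monoˡ-≤ t v≤n) (t<ρ , ρ-letters))

directSums : ℕ → ℕ → List (List ℕ)
directSums t m = concatMap (λ σ → map (σ ⊕_) (perms m)) (perms t)

directSums-unique : ∀ t m → Unique (directSums t m)
directSums-unique t m =
  unique-concatMap⁺ _ (perms-unique t) (λ σ → Unique.map⁺ (⊕-injectiveʳ σ) (perms-unique m)) same-prefix
  where
  same-prefix : ∀ {σ σ′ π} → σ ∈ perms t → σ′ ∈ perms t →
    π ∈ map (σ ⊕_) (perms m) → π ∈ map (σ′ ⊕_) (perms m) → σ ≡ σ′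
  same-prefix {σ} {σ′} σ∈ σ′∈ π∈ π∈′ with ∈-map⁻ (σ ⊕_) π∈ | ∈-map⁻ (σ′ ⊕_) π∈′
  ... | τ , _ , refl | τ′ , _ , eq = begin
    σ                              ≡⟨ take-length-⊕ σ τ ⟨
    take (length σ) (σ ⊕ τ)        ≡⟨ cong₂ take same-length eq ⟩
    take (length σ′) (σ′ ⊕ τ′)     ≡⟨ take-length-⊕ σ′ τ′ ⟩
    σ′                             ∎
    where
    open ≡-Reasoning
    same-length : length σ ≡ length σ′
    same-length =
      trans (IsPermutation.length≡ (∈-perms⁻ t σ∈)) (sym (IsPermutation.length≡ (∈-perms⁻ t σ′∈)))

∈-directSums⁻ : ∀ t m {π} → π ∈ directSums t m → IsPermutation (t + m) π
∈-directSums⁻ t m π∈ with find (∈-concatMap⁻ (λ σ → map (σ ⊕_) (perms m)) {xs = perms t} π∈)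
... | σ , σ∈ , π∈σ⊕ with ∈-map⁻ (σ ⊕_) π∈σ⊕
... | τ , τ∈ , refl = ⊕-isPermutation (∈-perms⁻ t σ∈) (∈-perms⁻ m τ∈)

∈-directSums⁺ : ∀ t m {π} → π ∈ perms (t + m) → init π ≡ t → 1 ≤ m → π ∈ directSums t m
∈-directSums⁺ t m {π} π∈ init≡t 1≤m =
  ∈-concatMap⁺ (λ σ → map (σ ⊕_) (perms m))
    (lose (∈-perms⁺ t σ-perm)
          (subst (_∈ map (σ ⊕_) (perms m)) σ⊕τ≡π (∈-map⁺ (σ ⊕_) (∈-perms⁺ m τ-perm))))
  where
  π-perm : IsPermutation (t + m) π
  π-perm = ∈-perms⁻ (t + m) π∈
  σ ρ : List ℕ
  σ = take t π
  ρ = drop t π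
  prefix-holds : T (prefixIsInterval π t)
  prefix-holds = subst (T ∘ prefixIsInterval π) init≡t
    (init-prefixIsInterval π (subst₂ _<_ (sym init≡t) (sym (IsPermutation.length≡ π-perm)) (m<m+n t 1≤m)))
  σ-perm : IsPermutation t σ
  σ-perm = take-isPermutation π-perm (m≤m+n t m) prefix-holds
  split : All (t <_) ρ × IsPermutation (t + m ∸ t) (map (_∸ t) ρ)
  split = ++⁻ʳ-isPermutation σ ρ (subst (IsPermutation (t + m)) (sym (take++drop≡id t π)) π-perm) σ-perm
  τ-perm : IsPermutation m (map (_∸ t) ρ)
  τ-perm = subst (λ n → IsPermutation n _) (m+n∸m≡n t m) (proj₂ split)
  σ⊕τ≡π : σ ⊕ map (_∸ t) ρ ≡ π
  σ⊕τ≡π rewrite IsPermutation.length≡ σ-perm | map-+-∸ ρ (All.map <⇒≤ (proj₁ split)) = take++drop≡id t π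

des-⊕ : ∀ {t m σ τ} → IsPermutation t σ → IsPermutation m τ → des (σ ⊕ τ) ≡ des σ + des τ
des-⊕ {τ = τ} (isPermutation refl σ-letters _) τ-perm =
  des-++-map-+ τ σ-letters (All.map proj₁ (IsPermutation.letters τ-perm))

-- Rows of H_k

h₀ : ℕ → ℕ → ℕ → ℕ
h₀ k t j = h k t (suc j)

h₀≡count-directSums : ∀ t m j → 1 ≤ m →
  h₀ (t + m) t j ≡ count (λ π → (init π ≡ᵇ t) ∧ (des π ≡ᵇ j)) (directSums t m)
h₀≡count-directSums t m j 1≤m = count-unique-cong _ (perms-unique (t + m)) (directSums-unique t m)
  (λ holds π∈ → ∈-directSums⁺ t m π∈ (≡ᵇ⇒≡ _ t (proj₁ (Equivalence.to T-∧ holds))) 1≤m)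
  (λ _ π∈ → ∈-perms⁺ (t + m) (∈-directSums⁻ t m π∈))

h₀-+ : ∀ t m j → 1 ≤ t → 1 ≤ m → h₀ (t + m) t j ≡ sum (map (λ l → h₀ t t l * A m (j ∸ l)) (range 0 j))
h₀-+ t m j 1≤t 1≤m = begin
  h₀ (t + m) t j
    ≡⟨ h₀≡count-directSums t m j 1≤m ⟩
  count q (directSums t m)
    ≡⟨ count-concatMap q _ (perms t) ⟩
  sum (map (λ σ → count q (map (σ ⊕_) (perms m))) (perms t))
    ≡⟨ sum-map-cong (perms t) split ⟩
  sum (map (λ σ → count (λ τ → (init σ ≡ᵇ t) ∧ (des σ + des τ ≡ᵇ j)) (perms m)) (perms t))
    ≡⟨ count-+-convolution _ des des (perms t) (perms m) j ⟩
  sum (map (λ l → h₀ t t l * A m (j ∸ l)) (range 0 j))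
    ∎
  where
  open ≡-Reasoning
  q : List ℕ → Bool
  q π = (init π ≡ᵇ t) ∧ (des π ≡ᵇ j)
  split : ∀ {σ} → σ ∈ perms t →
    count q (map (σ ⊕_) (perms m)) ≡ count (λ τ → (init σ ≡ᵇ t) ∧ (des σ + des τ ≡ᵇ j)) (perms m)
  split {σ} σ∈ = trans (count-map q (σ ⊕_) (perms m)) (count-cong (perms m) λ τ∈ →
    let σ-perm = ∈-perms⁻ t σ∈ in
    cong₂ (λ i d → (i ≡ᵇ t) ∧ (d ≡ᵇ j)) (init-++ _ σ-perm 1≤t) (des-⊕ σ-perm (∈-perms⁻ m τ∈)))

h₀-convolution : ∀ {k t} j → 1 ≤ t → t < k →
  h₀ k t j ≡ sum (map (λ l → h₀ t t l * A (k ∸ t) (j ∸ l)) (range 0 j))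
h₀-convolution {k} {t} j 1≤t t<k =
  subst (λ n → h₀ n t j ≡ sum (map (λ l → h₀ t t l * A (k ∸ t) (j ∸ l)) (range 0 j)))
        (m+[n∸m]≡n (<⇒≤ t<k)) (h₀-+ t (k ∸ t) j 1≤t (m<n⇒0<n∸m t<k))

at-hrow : ∀ k t j → 1 ≤ k → at (hrow k t) j ≡ h₀ k t j
at-hrow k t j 1≤k with j <? k
... | yes j<k = at-map-range (h k t) 1 k j<k
... | no  j≮k = trans (at-map-range-≥ (h k t) 1 k (≮⇒≥ j≮k)) (sym (count-none (perms k) λ {π} π∈ →
  trans (cong ((init π ≡ᵇ t) ∧_) (des≡ᵇ-false k π∈ k-1<j)) (∧-zeroʳ _)))
  where
  k-1<j : k ∸ 1 < j
  k-1<j = <-≤-trans (∸-monoˡ-< (n<1+n _) 1≤k) (≮⇒≥ j≮k)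

at-hSd : ∀ m j → at (hSd m) j ≡ A m j
at-hSd m j with j <? suc (m ∸ 1)
... | yes j< = at-map-range (A m) 0 (m ∸ 1) j<
... | no  j≮ = trans (at-map-range-≥ (A m) 0 (m ∸ 1) (≮⇒≥ j≮))
                    (sym (count-none (perms m) λ π∈ → des≡ᵇ-false m π∈ (≮⇒≥ j≮)))

A≡sum-h₀ : ∀ k j → 1 ≤ k → A k j ≡ sum (map (λ i → h₀ k i j) (range 1 k))
A≡sum-h₀ k j 1≤k = begin
  A k j
    ≡⟨ count≡sum-ind _ (perms k) ⟩
  sum (map (λ π → ind (des π ≡ᵇ j)) (perms k))
    ≡⟨ sum-map-cong (perms k) init-unique ⟨
  sum (map (λ π → sum (map (λ i → ind ((init π ≡ᵇ i) ∧ (des π ≡ᵇ j))) (range 1 k))) (perms k))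
    ≡⟨ sum-map-swap (λ π i → ind ((init π ≡ᵇ i) ∧ (des π ≡ᵇ j))) (perms k) (range 1 k) ⟩
  sum (map (λ i → sum (map (λ π → ind ((init π ≡ᵇ i) ∧ (des π ≡ᵇ j))) (perms k))) (range 1 k))
    ≡⟨ sum-map-cong (range 1 k) (λ _ → sym (count≡sum-ind _ (perms k))) ⟩
  sum (map (λ i → h₀ k i j) (range 1 k))
    ∎
  where
  open ≡-Reasoning
  init-unique : ∀ {π} → π ∈ perms k →
    sum (map (λ i → ind ((init π ≡ᵇ i) ∧ (des π ≡ᵇ j))) (range 1 k)) ≡ ind (des π ≡ᵇ j)
  init-unique {π} π∈ with init-letter (∈-perms⁻ k π∈) 1≤k
  ... | 1≤init , init≤k = trans (sum-map-cong (range 1 k) (λ {i} _ → ind-∧ (init π ≡ᵇ i) _))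
    (sum-map-δ _ (range 1 k) (range-unique 1 k) (∈-range⁺ 1≤init init≤k))

h₀-1-1 : ∀ l → h₀ 1 1 l ≡ δ 0 l
h₀-1-1 l = +-identityʳ (δ 0 l)

hrow-first : ∀ k → 2 ≤ k → hrow k 1 ≈ (hSd (k ∸ 1) ∷ʳ' 0)
hrow-first k 2≤k j = begin
  at (hrow k 1) j
    ≡⟨ at-hrow k 1 j (<⇒≤ 2≤k) ⟩
  h₀ k 1 j
    ≡⟨ h₀-convolution j ≤-refl 2≤k ⟩
  sum (map (λ l → h₀ 1 1 l * A (k ∸ 1) (j ∸ l)) (range 0 j))
    ≡⟨ sum-map-cong (range 0 j) (λ {l} _ → cong (_* A (k ∸ 1) (j ∸ l)) (h₀-1-1 l)) ⟩
  sum (map (λ l → δ 0 l * A (k ∸ 1) (j ∸ l)) (range 0 j))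
    ≡⟨ sum-map-δ _ (range 0 j) (range-unique 0 j) (∈-range⁺ z≤n z≤n) ⟩
  A (k ∸ 1) j
    ≡⟨ at-hSd (k ∸ 1) j ⟨
  at (hSd (k ∸ 1)) j
    ≡⟨ at-∷ʳ'-0 (hSd (k ∸ 1)) j ⟨
  at (hSd (k ∸ 1) ∷ʳ' 0) j
    ∎
  where open ≡-Reasoning

hrow-convolution : ∀ k t → 1 ≤ t → t < k → hrow k t ≈ (hrow t t ⊛ hSd (k ∸ t))
hrow-convolution k t 1≤t t<k j = begin
  at (hrow k t) j
    ≡⟨ at-hrow k t j (≤-trans 1≤t (<⇒≤ t<k)) ⟩
  h₀ k t j
    ≡⟨ h₀-convolution j 1≤t t<k ⟩
  sum (map (λ l → h₀ t t l * A (k ∸ t) (j ∸ l)) (range 0 j))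
    ≡⟨ sum-map-cong (range 0 j) (λ {l} _ → sym (cong₂ _*_ (at-hrow t t l 1≤t) (at-hSd (k ∸ t) (j ∸ l)))) ⟩
  sum (map (λ l → at (hrow t t) l * at (hSd (k ∸ t)) (j ∸ l)) (range 0 j))
    ≡⟨ at-⊛ (hrow t t) (hSd (k ∸ t)) j ⟨
  at (hrow t t ⊛ hSd (k ∸ t)) j
    ∎
  where open ≡-Reasoning

-- Imported only here: its prefix `+_` would make the sections `(n +_)` above ambiguous.
open import Data.Integer using (+_; _-_; _⊖_)
import Data.Integer.Properties as ℤ

hrow-last : ∀ k j → 1 ≤ k →
  + at (hrow k k) j ≡ (+ at (hSd k) j) - (+ sum (map (λ i → at (hrow k i) j) (range 1 (k ∸ 1))))
hrow-last k@(suc n) j 1≤k = sym (begin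
  (+ at (hSd k) j) - (+ sum (map (λ i → at (hrow k i) j) (range 1 n)))
    ≡⟨ cong₂ (λ a b → (+ a) - (+ b)) A-split (sum-map-cong (range 1 n) (λ {i} _ → at-hrow k i j 1≤k)) ⟩
  (+ (S + h₀ k k j)) - (+ S)  ≡⟨ ℤ.[+m]-[+n]≡m⊖n (S + h₀ k k j) S ⟩
  (S + h₀ k k j) ⊖ S          ≡⟨ ℤ.≤-⊖ (m≤m+n S (h₀ k k j)) ⟩
  + (S + h₀ k k j ∸ S)        ≡⟨ cong +_ (m+n∸m≡n S (h₀ k k j)) ⟩
  + h₀ k k j                  ≡⟨ cong +_ (at-hrow k k j 1≤k) ⟨
  + at (hrow k k) j           ∎)
  where
  open ≡-Reasoning
  S : ℕ
  S = sum (map (λ i → h₀ k i j) (range 1 n))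
  A-split : at (hSd k) j ≡ S + h₀ k k j
  A-split = trans (at-hSd k j) (trans (A≡sum-h₀ k j 1≤k) (sum-map-range-snoc (λ i → h₀ k i j) n))

mainTheorem16 : (k : ℕ) → 2 ≤ k →
    (hrow k 1 ≈ (hSd (k ∸ 1) ∷ʳ' 0))
    × ((t : ℕ) → 1 < t → t < k → hrow k t ≈ (hrow t t ⊛ hSd (k ∸ t)))
    × ((j : ℕ) → + at (hrow k k) j
         ≡ (+ at (hSd k) j) - (+ sum (map (λ i → at (hrow k i) j) (range 1 (k ∸ 1)))))
mainTheorem16 k 2≤k =
  hrow-first k 2≤k ,
  (λ t 1<t t<k → hrow-convolution k t (<⇒≤ 1<t) t<k) ,
  (λ j → hrow-last k j (<⇒≤ 2≤k))
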